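{- Let $(g_d)_{d\ge1}$ be a sequence of integer-valued functions on the positive integers such that $g_1(n)=0$ for all $n\ge1$ and $g_d(n)=g_d(\operatorname{rad}(n))$ for all $n\ge1$ and $d\mid n$. Then the sequence $a_n=\sum_{d\mid n} d\,\mu(d)\,g_d(n)$ is an Euler–Gauss sequence. In particular, for an arbitrary family $(f_p)_{p\text{ prime}}$ of integer-valued functions on the positive integers, the sequence $a_n=\sum_{p\mid n,\ p\text{ prime}} p\, f_p(\operatorname{rad}(n))$ is an Euler–Gauss sequence.
   Context: $\mu$ is the Möbius function; $\operatorname{rad}(n)=\prod_{p\mid n,\,p\text{ prime}}p$ is the square-free kernel of $n$ (with $\operatorname{rad}(1)=1$). An integer sequence $(a_n)_{n\ge1}$ is an Euler–Gauss sequence if for all $n\ge1$, $\prod_{d\mid n,\ \mu(d)=1} a_{n/d}\equiv \prod_{d\mid n,\ \mu(d)=-1} a_{n/d}\pmod n$ (an empty product equals $1$). -}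

module Defs where

open import Data.Nat as ℕ using (ℕ; zero; suc; _≤_)
open import Data.Nat.Divisibility using (_∣?_)
open import Data.Nat.DivMod using (_/_)
open import Data.Nat.Primality using (prime?)
open import Data.Integer as ℤ using (ℤ; +_; -_)
open import Data.Integer.Divisibility as ℤD using ()
open import Data.List using (List; filter; length; map; foldr; upTo)
open import Data.Bool using (Bool; if_then_else_)
open import Relation.Nullary using (does; ¬?)
open import Relation.Binary.PropositionalEquality using (_≡_)

-- positive divisors of n (for n ≥ 1), in increasing order; divisors 0 = []
divisors : ℕ → List ℕ
divisors n = filter (λ d → d ∣? n) (map suc (upTo n))

primeDivisors : ℕ → List ℕ
primeDivisors n = filter prime? (divisors n)

sumℤ : List ℤ → ℤ
sumℤ = foldr ℤ._+_ (+ 0)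

prodℤ : List ℤ → ℤ
prodℤ = foldr ℤ._*_ (+ 1)

rad : ℕ → ℕ
rad n = foldr ℕ._*_ 1 (primeDivisors n)

squarefree : ℕ → Bool
squarefree n = foldr (λ k b → Data.Bool._∧_ (Data.Bool.not (does ((k ℕ.* k) ∣? n))) b) Data.Bool.true
                     (filter (λ k → 2 ℕ.≤? k) (divisors n))
  where import Data.Bool

μ : ℕ → ℤ
μ n = if squarefree n then (ℤ.-1ℤ ℤ.^ length (primeDivisors n)) else + 0

-- exact quotient n / d (d ≥ 1); only used for divisors d of n
quot : ℕ → ℕ → ℕ
quot n zero = zero
quot n (suc k) = n / suc k

-- Euler–Gauss sequence (a_n)_{n ≥ 1}, given as a : ℕ → ℤ (value at 0 irrelevant):
-- for every n ≥ 1,  ∏_{d ∣ n, μ(d)=1} a(n/d) ≡ ∏_{d ∣ n, μ(d)=-1} a(n/d)  (mod n)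
EulerGauss : (ℕ → ℤ) → Set
EulerGauss a =
  ∀ (n : ℕ) → 1 ≤ n →
    (+ n) ℤD.∣
      (prodℤ (map (λ d → a (quot n d)) (filter (λ d → μ d ℤ.≟ ℤ.1ℤ) (divisors n)))
       ℤ.- prodℤ (map (λ d → a (quot n d)) (filter (λ d → μ d ℤ.≟ ℤ.-1ℤ) (divisors n))))

{-# OPTIONS --safe #-}
module Submission where

-- If a(pN) = a(N) whenever a prime p divides N, a(1) = 0 and p ∣ a(p) for every prime p, then a is
-- Euler–Gauss. When p² ∣ n, d ↦ pd pairs the divisors with μ(d) = s, p ∤ d with those with
-- μ(d) = -s, p ∣ d without changing a(n/d), so the two products agree. When n is square-free, the
-- product over μ(d) = μ(n) contains a(n/n) = a(1) = 0, while the other one contains a(n/(n/p)) = a(p)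
-- for every prime p ∣ n, so it is divisible by each prime factor of n and hence by n.
-- Both sequences satisfy the three conditions. In the first one only square-free d contribute; for
-- p ∣ N those dividing pN already divide N and see g_d(pN) = g_d(rad N) = g_d(N), and a(p) is a
-- multiple of p because g_1 = 0.

open import Defs
open import Algebra.Core using (Op₂)
open import Algebra.Structures using (IsCommutativeMonoid)
open import Data.Bool using (Bool; true; false; _∧_; not)
open import Data.Empty using (⊥-elim)
open import Data.Integer as ℤ using (ℤ; +_)
import Data.Integer.Properties as ℤ
open import Data.Integer.Divisibility.Signed as ℤ∣ using ()
open import Data.List using (List; []; _∷_; map; filter; foldr; upTo; length)
open import Data.List.Properties using (map-∘)
open import Data.List.Membership.Propositional using (_∈_)
open import Data.List.Membership.Propositional.Properties
  using (∈-filter⁺; ∈-filter⁻; ∈-map⁺; ∈-map⁻; ∈-upTo⁺)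
open import Data.List.Membership.Propositional.Properties.WithK using (unique∧set⇒bag)
open import Data.List.Relation.Binary.BagAndSetEquality using (∼bag⇒↭)
open import Data.List.Relation.Binary.Permutation.Propositional using (_↭_; ↭⇒↭ₛ)
open import Data.List.Relation.Binary.Permutation.Propositional.Properties as ↭ using ()
open import Data.List.Relation.Binary.Permutation.Setoid.Properties using (foldr-commMonoid)
open import Data.List.Relation.Unary.All as All using (All; []; _∷_)
open import Data.List.Relation.Unary.AllPairs using (_∷_)
open import Data.List.Relation.Unary.Any using (here; there)
open import Data.List.Relation.Unary.Unique.Propositional using (Unique)
import Data.List.Relation.Unary.Unique.Propositional.Properties as Unique
open import Data.Nat as ℕ using (ℕ; zero; suc; _*_; _≤_; _<_; s≤s; z≤n)
import Data.Nat.Properties as ℕ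
open import Data.Nat.Coprimality using (Coprime; coprime-divisor)
open import Data.Nat.Divisibility
  using (_∣_; _∣?_; divides; quotient; ∣-trans; 1∣_; m∣m*n; n∣m*n; m*n∣⇒m∣; *-cancelˡ-∣; *-pres-∣
        ; ∣-refl; quotient-∣; quotient-<; ∣⇒≤; m∣n⇒n≡m*quotient; 0∣⇒≡0)
open import Data.Nat.DivMod using (m*n/n≡m)
open import Data.Nat.Induction using (<-rec)
open import Data.Nat.ListAction.Properties using (product-↭)
open import Data.Nat.Primality
  using (Prime; prime?; euclidsLemma; prime⇒irreducible; prime⇒nonTrivial; prime⇒nonZero; ¬prime[1])
open import Data.Nat.Primality.Factorisation using (factorise)
open import Data.Product using (_×_; _,_; proj₂; ∃-syntax)
open import Data.Sum using (_⊎_; inj₁; inj₂; reduce; fromInj₁)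
open import Function using (_∘_; case_of_; mk⇔)
open import Relation.Nullary using (¬_; yes; no; does; ¬?; contradiction)
open import Relation.Unary using (Pred; Decidable)
open import Relation.Binary.PropositionalEquality

private
  variable
    I : Set
    d e k m n p q N X : ℕ
    xs ys : List I

module BigOperator {A : Set} {_∙_ : Op₂ A} {ε : A}
                   (isCommutativeMonoid : IsCommutativeMonoid _≡_ _∙_ ε) where

  open IsCommutativeMonoid isCommutativeMonoid using (assoc; comm; identityˡ)

  ⨀ : (I → A) → List I → A
  ⨀ f xs = foldr _∙_ ε (map f xs)

  ⨀-↭ : ∀ (f : I → A) → xs ↭ ys → ⨀ f xs ≡ ⨀ f ys
  ⨀-↭ f xs↭ys =
    foldr-commMonoid (setoid A) isCommutativeMonoid (↭⇒↭ₛ (↭.map⁺ f xs↭ys))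

  ⨀-cong : ∀ {f g : I → A} xs → (∀ {x} → x ∈ xs → f x ≡ g x) → ⨀ f xs ≡ ⨀ g xs
  ⨀-cong []       f≗g = refl
  ⨀-cong (x ∷ xs) f≗g = cong₂ _∙_ (f≗g (here refl)) (⨀-cong xs (f≗g ∘ there))

  ⨀-map : ∀ {J : Set} (f : J → A) (h : I → J) xs → ⨀ f (map h xs) ≡ ⨀ (f ∘ h) xs
  ⨀-map f h xs = cong (foldr _∙_ ε) (sym (map-∘ xs))

  ⨀-ε : ∀ {f : I → A} xs → (∀ {x} → x ∈ xs → f x ≡ ε) → ⨀ f xs ≡ ε
  ⨀-ε xs f≗ε = trans (⨀-cong xs f≗ε) (ε-only xs)
    where
    ε-only : ∀ (xs : List I) → ⨀ (λ _ → ε) xs ≡ ε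
    ε-only []       = refl
    ε-only (_ ∷ xs) = trans (cong (ε ∙_) (ε-only xs)) (identityˡ ε)

  ⨀-filter : ∀ {ℓ} {P : Pred I ℓ} (P? : Decidable P) (f : I → A) xs →
             ⨀ f xs ≡ ⨀ f (filter P? xs) ∙ ⨀ f (filter (¬? ∘ P?) xs)
  ⨀-filter P? f []       = sym (identityˡ ε)
  ⨀-filter P? f (x ∷ xs) with P? x
  ... | yes _ = trans (cong (f x ∙_) (⨀-filter P? f xs)) (sym (assoc _ _ _))
  ... | no  _ = begin
    f x ∙ ⨀ f xs          ≡⟨ cong (f x ∙_) (⨀-filter P? f xs) ⟩
    f x ∙ (⨀ᵀ ∙ ⨀ᶠ)       ≡⟨ sym (assoc _ _ _) ⟩
    (f x ∙ ⨀ᵀ) ∙ ⨀ᶠ       ≡⟨ cong (_∙ ⨀ᶠ) (comm _ _) ⟩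
    (⨀ᵀ ∙ f x) ∙ ⨀ᶠ       ≡⟨ assoc _ _ _ ⟩
    ⨀ᵀ ∙ (f x ∙ ⨀ᶠ)       ∎
    where
    open ≡-Reasoning
    ⨀ᵀ ⨀ᶠ : A
    ⨀ᵀ = ⨀ f (filter P? xs)
    ⨀ᶠ = ⨀ f (filter (¬? ∘ P?) xs)

open BigOperator ℤ.+-0-isCommutativeMonoid public
  using () renaming (⨀ to ∑; ⨀-↭ to ∑-↭; ⨀-cong to ∑-cong; ⨀-ε to ∑-0; ⨀-filter to ∑-filter)
open BigOperator ℤ.*-1-isCommutativeMonoid public
  using () renaming (⨀ to ∏; ⨀-↭ to ∏-↭; ⨀-cong to ∏-cong; ⨀-map to ∏-map; ⨀-filter to ∏-filter)

∣0 : ∀ k → k ℤ∣.∣ + 0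
∣0 k = ℤ∣.divides (+ 0) (sym (ℤ.*-zeroˡ k))

∈⇒∣∏ : ∀ (f : I → ℤ) {x} xs → x ∈ xs → f x ℤ∣.∣ ∏ f xs
∈⇒∣∏ f (_ ∷ xs) (here refl) = ℤ∣.∣m⇒∣m*n _ ℤ∣.∣-refl
∈⇒∣∏ f (y ∷ xs) (there x∈) = ℤ∣.∣n⇒∣m*n (f y) (∈⇒∣∏ f xs x∈)

∣-∑ : ∀ (f : I → ℤ) {k} xs → (∀ {x} → x ∈ xs → k ℤ∣.∣ f x) → k ℤ∣.∣ ∑ f xs
∣-∑ f {k} []       _   = ∣0 k
∣-∑ f     (x ∷ xs) k∣f = ℤ∣.∣m∣n⇒∣m+n (k∣f (here refl)) (∣-∑ f xs (k∣f ∘ there))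

unique∧sameElements⇒↭ : ∀ {xs ys : List ℕ} → Unique xs → Unique ys →
                         (∀ {x} → x ∈ xs → x ∈ ys) → (∀ {x} → x ∈ ys → x ∈ xs) → xs ↭ ys
unique∧sameElements⇒↭ xs! ys! xs⊆ys ys⊆xs = ∼bag⇒↭ (unique∧set⇒bag xs! ys! (mk⇔ xs⊆ys ys⊆xs))

-- Divisors and primes

∣⇒≥1 : 1 ≤ n → d ∣ n → 1 ≤ d
∣⇒≥1 {d = zero}  (s≤s _) 0∣n = ⊥-elim (ℕ.1+n≢0 (0∣⇒≡0 0∣n))
∣⇒≥1 {d = suc _} _       _   = s≤s z≤n

∈-divisors⁺ : 1 ≤ n → d ∣ n → d ∈ divisors n
∈-divisors⁺ {n = suc n} 1≤n d∣n with s≤s _ ← ∣⇒≥1 1≤n d∣n =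
  ∈-filter⁺ (_∣? suc n) (∈-map⁺ suc (∈-upTo⁺ (∣⇒≤ d∣n))) d∣n

∈-divisors⁻ : d ∈ divisors n → d ∣ n
∈-divisors⁻ {n = n} d∈ = proj₂ (∈-filter⁻ (_∣? n) {xs = map suc (upTo n)} d∈)

divisors-unique : ∀ n → Unique (divisors n)
divisors-unique n = Unique.filter⁺ (_∣? n) (Unique.map⁺ ℕ.suc-injective (Unique.upTo⁺ n))

divisors-filter-∣ : 1 ≤ n → N ∣ n → filter (_∣? N) (divisors n) ↭ divisors N
divisors-filter-∣ {n} {N} 1≤n N∣n =
  unique∧sameElements⇒↭ (Unique.filter⁺ (_∣? N) (divisors-unique n)) (divisors-unique N) ⊆N N⊆
  where
  ⊆N : ∀ {d} → d ∈ filter (_∣? N) (divisors n) → d ∈ divisors N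
  ⊆N d∈ = ∈-divisors⁺ (∣⇒≥1 1≤n N∣n) (proj₂ (∈-filter⁻ (_∣? N) {xs = divisors n} d∈))
  N⊆ : ∀ {d} → d ∈ divisors N → d ∈ filter (_∣? N) (divisors n)
  N⊆ d∈ = ∈-filter⁺ (_∣? N) (∈-divisors⁺ 1≤n (∣-trans (∈-divisors⁻ d∈) N∣n)) (∈-divisors⁻ d∈)

∈-primeDivisors⁺ : 1 ≤ n → Prime q → q ∣ n → q ∈ primeDivisors n
∈-primeDivisors⁺ 1≤n q-prime q∣n = ∈-filter⁺ prime? (∈-divisors⁺ 1≤n q∣n) q-prime

∈-primeDivisors⁻ : q ∈ primeDivisors n → Prime q × q ∣ n
∈-primeDivisors⁻ {n = n} q∈ with q∈divisors , q-prime ← ∈-filter⁻ prime? {xs = divisors n} q∈ =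
  q-prime , ∈-divisors⁻ q∈divisors

primeDivisors-unique : ∀ n → Unique (primeDivisors n)
primeDivisors-unique n = Unique.filter⁺ prime? (divisors-unique n)

prime⇒≥1 : Prime p → 1 ≤ p
prime⇒≥1 {p = suc _} _ = s≤s z≤n

prime⇒≥2 : Prime p → 2 ≤ p
prime⇒≥2 {p = p} p-prime = ℕ.nonTrivial⇒n>1 p {{prime⇒nonTrivial p-prime}}

prime*≥1 : Prime p → 1 ≤ e → 1 ≤ p * e
prime*≥1 p-prime 1≤e = ℕ.*-mono-≤ (prime⇒≥1 p-prime) 1≤e

prime∣prime⇒≡ : Prime p → Prime q → p ∣ q → p ≡ q
prime∣prime⇒≡ p-prime q-prime p∣q with prime⇒irreducible q-prime p∣q
... | inj₁ refl = contradiction p-prime ¬prime[1]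
... | inj₂ p≡q  = p≡q

prime∤⇒coprime : Prime p → ¬ p ∣ m → Coprime m p
prime∤⇒coprime p-prime p∤m (d∣m , d∣p) with prime⇒irreducible p-prime d∣p
... | inj₁ d≡1 = d≡1
... | inj₂ refl = contradiction d∣m p∤m

prime∤∧∣⇒*∣ : Prime p → ¬ p ∣ m → m ∣ X → p ∣ X → p * m ∣ X
prime∤∧∣⇒*∣ {m = m} p-prime p∤m (divides k refl) p∣km with euclidsLemma k m p-prime p∣km
... | inj₁ (divides j refl) = divides j (ℕ.*-assoc j _ m)
... | inj₂ p∣m              = contradiction p∣m p∤m

prime∣p*N⇒∣N : Prime p → Prime q → p ∣ N → q ∣ p * N → q ∣ N
prime∣p*N⇒∣N {p} {q} {N} p-prime q-prime p∣N q∣pN with euclidsLemma p N q-prime q∣pN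
... | inj₁ q∣p = subst (_∣ N) (sym (prime∣prime⇒≡ q-prime p-prime q∣p)) p∣N
... | inj₂ q∣N = q∣N

∃prime∣ : 2 ≤ n → ∃[ p ] Prime p × p ∣ n
∃prime∣ {n = 1} (s≤s ())
∃prime∣ {n = n@(suc (suc _))} _ with factorise n
... | record { factors = [] ; isFactorisation = () }
... | record { factors = p ∷ _ ; isFactorisation = n≡∏ ; factorsPrime = p-prime ∷ _ } =
  p , p-prime , subst (p ∣_) (sym n≡∏) (m∣m*n _)

-- Square-free numbers and the Möbius function

SquareFree : ℕ → Set
SquareFree n = ∀ {q} → Prime q → ¬ q * q ∣ n

squareFree-∣ : d ∣ n → SquareFree n → SquareFree d
squareFree-∣ d∣n n-sf q-prime q²∣d = n-sf q-prime (∣-trans q²∣d d∣n)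

squareFree⇒∤ : Prime p → SquareFree (p * m) → ¬ p ∣ m
squareFree⇒∤ {p = p} p-prime pm-sf p∣m = pm-sf p-prime (*-pres-∣ (∣-refl {p}) p∣m)

squareFree-* : Prime p → ¬ p ∣ e → SquareFree e → SquareFree (p * e)
squareFree-* {p = p} p-prime p∤e e-sf {q} q-prime q²∣pe with q ℕ.≟ p
... | yes refl = p∤e (*-cancelˡ-∣ q {{prime⇒nonZero q-prime}} q²∣pe)
... | no  q≢p  = e-sf q-prime (coprime-divisor (prime∤⇒coprime p-prime p∤q²) q²∣pe)
  where
  p∤q² : ¬ p ∣ q * q
  p∤q² p∣q² = q≢p (sym (prime∣prime⇒≡ p-prime q-prime (reduce (euclidsLemma q q p-prime p∣q²))))

squareFree⇒∣ : ∀ n → 1 ≤ n → SquareFree n → (∀ {p} → Prime p → p ∣ n → p ∣ X) → n ∣ X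
squareFree⇒∣ {X = X} = <-rec Goal go
  where
  Goal : ℕ → Set
  Goal n = 1 ≤ n → SquareFree n → (∀ {p} → Prime p → p ∣ n → p ∣ X) → n ∣ X
  go : ∀ n → (∀ {m} → m < n → Goal m) → Goal n
  go 1 _ _ _ _ = 1∣ X
  go n@(suc (suc _)) ih 1≤n n-sf primes∣X with p , p-prime , p∣n ← ∃prime∣ {n = n} (s≤s (s≤s z≤n)) =
    subst (_∣ X) (sym n≡p*n/p) (prime∤∧∣⇒*∣ p-prime p∤n/p n/p∣X (primes∣X p-prime p∣n))
    where
    n/p : ℕ
    n/p = quotient p∣n
    n≡p*n/p : n ≡ p * n/p
    n≡p*n/p = m∣n⇒n≡m*quotient p∣n
    n/p∣n : n/p ∣ n
    n/p∣n = quotient-∣ p∣n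
    p∤n/p : ¬ p ∣ n/p
    p∤n/p = squareFree⇒∤ p-prime (subst SquareFree n≡p*n/p n-sf)
    n/p∣X : n/p ∣ X
    n/p∣X = ih (quotient-< p∣n {{prime⇒nonTrivial p-prime}}) (∣⇒≥1 1≤n n/p∣n)
             (squareFree-∣ n/p∣n n-sf) (λ q-prime q∣n/p → primes∣X q-prime (∣-trans q∣n/p n/p∣n))

squareFree∧∣p*N⇒∣N : Prime p → p ∣ N → 1 ≤ d → SquareFree d → d ∣ p * N → d ∣ N
squareFree∧∣p*N⇒∣N p-prime p∣N 1≤d d-sf d∣pN =
  squareFree⇒∣ _ 1≤d d-sf (λ q-prime q∣d → prime∣p*N⇒∣N p-prime q-prime p∣N (∣-trans q∣d d∣pN))

-- squarefree n unfolds to noSquareDivisorIn n (filter (2 ≤?_) (divisors n)).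
noSquareDivisorIn : ℕ → List ℕ → Bool
noSquareDivisorIn n = foldr (λ k b → not (does ((k * k) ∣? n)) ∧ b) true

noSquareDivisorIn-true : ∀ ks → noSquareDivisorIn n ks ≡ true → All (λ k → ¬ k * k ∣ n) ks
noSquareDivisorIn-true []       _ = []
noSquareDivisorIn-true {n} (k ∷ ks) none with (k * k) ∣? n
... | yes _     = case none of λ ()
... | no  k²∤n  = k²∤n ∷ noSquareDivisorIn-true ks none

noSquareDivisorIn-false : ∀ ks → noSquareDivisorIn n ks ≡ false → ∃[ k ] k ∈ ks × k * k ∣ n
noSquareDivisorIn-false {n} (k ∷ ks) some with (k * k) ∣? n
... | yes k²∣n = k , here refl , k²∣n
... | no  _ with k′ , k′∈ , k′²∣n ← noSquareDivisorIn-false ks some = k′ , there k′∈ , k′²∣n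

squarefree⇒SquareFree : 1 ≤ n → squarefree n ≡ true → SquareFree n
squarefree⇒SquareFree {n} 1≤n sf {q} q-prime q²∣n =
  All.lookup (noSquareDivisorIn-true (filter (2 ℕ.≤?_) (divisors n)) sf)
             (∈-filter⁺ (2 ℕ.≤?_) (∈-divisors⁺ 1≤n (m*n∣⇒m∣ q q q²∣n)) (prime⇒≥2 q-prime))
             q²∣n

squarefree≡false⇒square : squarefree n ≡ false → ∃[ q ] Prime q × q * q ∣ n
squarefree≡false⇒square {n} not-sf =
  let k , k∈ , k²∣n = noSquareDivisorIn-false (filter (2 ℕ.≤?_) (divisors n)) not-sf
      q , q-prime , q∣k = ∃prime∣ (proj₂ (∈-filter⁻ (2 ℕ.≤?_) {xs = divisors n} k∈))
  in q , q-prime , ∣-trans (*-pres-∣ q∣k q∣k) k²∣n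

squareFree-dichotomy : 1 ≤ n → SquareFree n ⊎ ∃[ q ] Prime q × q * q ∣ n
squareFree-dichotomy {n} 1≤n with squarefree n in sf
... | true  = inj₁ (squarefree⇒SquareFree 1≤n sf)
... | false = inj₂ (squarefree≡false⇒square sf)

μ-SquareFree : SquareFree n → μ n ≡ ℤ.-1ℤ ℤ.^ length (primeDivisors n)
μ-SquareFree {n} n-sf with squarefree n in sf
... | true  = refl
... | false = let q , q-prime , q²∣n = squarefree≡false⇒square sf in contradiction q²∣n (n-sf q-prime)

μ-square : 1 ≤ n → Prime q → q * q ∣ n → μ n ≡ + 0
μ-square {n} 1≤n q-prime q²∣n with squarefree n in sf
... | true  = contradiction q²∣n (squarefree⇒SquareFree 1≤n sf q-prime)
... | false = refl

μ≢0⇒SquareFree : 1 ≤ n → μ n ≢ + 0 → SquareFree n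
μ≢0⇒SquareFree 1≤n μn≢0 with squareFree-dichotomy 1≤n
... | inj₁ n-sf                  = n-sf
... | inj₂ (_ , q-prime , q²∣n) = contradiction (μ-square 1≤n q-prime q²∣n) μn≢0

μ-SquareFree-±1 : SquareFree n → μ n ≡ ℤ.1ℤ ⊎ μ n ≡ ℤ.-1ℤ
μ-SquareFree-±1 {n} n-sf rewrite μ-SquareFree n-sf = -1^k≡±1 (length (primeDivisors n))
  where
  -1^k≡±1 : ∀ k → ℤ.-1ℤ ℤ.^ k ≡ ℤ.1ℤ ⊎ ℤ.-1ℤ ℤ.^ k ≡ ℤ.-1ℤ
  -1^k≡±1 zero    = inj₁ refl
  -1^k≡±1 (suc k) with -1^k≡±1 k
  ... | inj₁ ≡1  = inj₂ (cong (ℤ.-1ℤ ℤ.*_) ≡1)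
  ... | inj₂ ≡-1 = inj₁ (cong (ℤ.-1ℤ ℤ.*_) ≡-1)

primeDivisors-*-∤ : Prime p → 1 ≤ e → ¬ p ∣ e → primeDivisors (p * e) ↭ p ∷ primeDivisors e
primeDivisors-*-∤ {p} {e} p-prime 1≤e p∤e =
  unique∧sameElements⇒↭ (primeDivisors-unique (p * e)) p∷e-unique ⊆p∷e p∷e⊆
  where
  p∷e-unique : Unique (p ∷ primeDivisors e)
  p∷e-unique = All.tabulate (λ q∈ p≡q → p∤e (subst (_∣ e) (sym p≡q) (proj₂ (∈-primeDivisors⁻ q∈))))
             ∷ primeDivisors-unique e
  ⊆p∷e : ∀ {q} → q ∈ primeDivisors (p * e) → q ∈ p ∷ primeDivisors e
  ⊆p∷e q∈ with q-prime , q∣pe ← ∈-primeDivisors⁻ q∈ with euclidsLemma p e q-prime q∣pe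
  ... | inj₁ q∣p = here (prime∣prime⇒≡ q-prime p-prime q∣p)
  ... | inj₂ q∣e = there (∈-primeDivisors⁺ 1≤e q-prime q∣e)
  p∷e⊆ : ∀ {q} → q ∈ p ∷ primeDivisors e → q ∈ primeDivisors (p * e)
  p∷e⊆ (here refl) = ∈-primeDivisors⁺ (prime*≥1 p-prime 1≤e) p-prime (m∣m*n e)
  p∷e⊆ (there q∈) with q-prime , q∣e ← ∈-primeDivisors⁻ q∈ =
    ∈-primeDivisors⁺ (prime*≥1 p-prime 1≤e) q-prime (∣-trans q∣e (n∣m*n p))

primeDivisors-*-∣ : Prime p → 1 ≤ N → p ∣ N → primeDivisors (p * N) ↭ primeDivisors N
primeDivisors-*-∣ {p} {N} p-prime 1≤N p∣N =
  unique∧sameElements⇒↭ (primeDivisors-unique (p * N)) (primeDivisors-unique N) ⊆N N⊆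
  where
  ⊆N : ∀ {q} → q ∈ primeDivisors (p * N) → q ∈ primeDivisors N
  ⊆N q∈ with q-prime , q∣pN ← ∈-primeDivisors⁻ q∈ =
    ∈-primeDivisors⁺ 1≤N q-prime (prime∣p*N⇒∣N p-prime q-prime p∣N q∣pN)
  N⊆ : ∀ {q} → q ∈ primeDivisors N → q ∈ primeDivisors (p * N)
  N⊆ q∈ with q-prime , q∣N ← ∈-primeDivisors⁻ q∈ =
    ∈-primeDivisors⁺ (prime*≥1 p-prime 1≤N) q-prime (∣-trans q∣N (n∣m*n p))

rad-*-∣ : Prime p → 1 ≤ N → p ∣ N → rad (p * N) ≡ rad N
rad-*-∣ p-prime 1≤N p∣N = product-↭ (primeDivisors-*-∣ p-prime 1≤N p∣N)

μ-*-prime : Prime p → 1 ≤ e → ¬ p ∣ e → μ (p * e) ≡ ℤ.- μ e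
μ-*-prime {p} {e} p-prime 1≤e p∤e with squareFree-dichotomy 1≤e
... | inj₁ e-sf = begin
  μ (p * e)
    ≡⟨ μ-SquareFree (squareFree-* p-prime p∤e e-sf) ⟩
  ℤ.-1ℤ ℤ.^ length (primeDivisors (p * e))
    ≡⟨ cong (ℤ.-1ℤ ℤ.^_) (↭.↭-length (primeDivisors-*-∤ p-prime 1≤e p∤e)) ⟩
  ℤ.-1ℤ ℤ.* ℤ.-1ℤ ℤ.^ length (primeDivisors e)
    ≡⟨ ℤ.-1*i≡-i _ ⟩
  ℤ.- (ℤ.-1ℤ ℤ.^ length (primeDivisors e))
    ≡⟨ cong ℤ.-_ (μ-SquareFree e-sf) ⟨
  ℤ.- μ e
    ∎
  where open ≡-Reasoning
... | inj₂ (q , q-prime , q²∣e) = begin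
  μ (p * e)  ≡⟨ μ-square (prime*≥1 p-prime 1≤e) q-prime (∣-trans q²∣e (n∣m*n p)) ⟩
  + 0        ≡⟨ cong ℤ.-_ (μ-square 1≤e q-prime q²∣e) ⟨
  ℤ.- μ e    ∎
  where open ≡-Reasoning

μ-*-prime⁻ : ∀ {s} → Prime p → 1 ≤ e → ¬ p ∣ e → μ (p * e) ≡ s → μ e ≡ ℤ.- s
μ-*-prime⁻ {p} {e} {s} p-prime 1≤e p∤e μpe≡s = begin
  μ e             ≡⟨ ℤ.neg-involutive (μ e) ⟨
  ℤ.- (ℤ.- μ e)   ≡⟨ cong ℤ.-_ (μ-*-prime p-prime 1≤e p∤e) ⟨
  ℤ.- μ (p * e)   ≡⟨ cong ℤ.-_ μpe≡s ⟩
  ℤ.- s           ∎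
  where open ≡-Reasoning

-- Euler–Gauss sequences

quot-≡ : 1 ≤ e → n ≡ k * e → quot n e ≡ k
quot-≡ {e = suc e} {k = k} _ refl = m*n/n≡m k (suc e)

RadicalInvariant : (ℕ → ℤ) → Set
RadicalInvariant a = ∀ {p N} → Prime p → 1 ≤ N → p ∣ N → a (p * N) ≡ a N

module EulerGaussCongruence (a : ℕ → ℤ) (a-rad : RadicalInvariant a) {n} (1≤n : 1 ≤ n) where

  term : ℕ → ℤ
  term d = a (quot n d)

  divisorsWithμ : ℤ → List ℕ
  divisorsWithμ s = filter (λ d → μ d ℤ.≟ s) (divisors n)

  divisorsWithμ-unique : ∀ s → Unique (divisorsWithμ s)
  divisorsWithμ-unique s = Unique.filter⁺ (λ d → μ d ℤ.≟ s) (divisors-unique n)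

  ∈-divisorsWithμ⁺ : ∀ {s} → d ∣ n → μ d ≡ s → d ∈ divisorsWithμ s
  ∈-divisorsWithμ⁺ {s = s} d∣n μd≡s = ∈-filter⁺ (λ d → μ d ℤ.≟ s) (∈-divisors⁺ 1≤n d∣n) μd≡s

  ∈-divisorsWithμ⁻ : ∀ {s} → d ∈ divisorsWithμ s → d ∣ n × μ d ≡ s
  ∈-divisorsWithμ⁻ {s = s} d∈
    with d∈divisors , μd≡s ← ∈-filter⁻ (λ d → μ d ℤ.≟ s) {xs = divisors n} d∈ =
    ∈-divisors⁻ d∈divisors , μd≡s

  module NonSquareFree {p} (p-prime : Prime p) (p²∣n : p * p ∣ n) where

    instance
      p≢0 : ℕ.NonZero p
      p≢0 = prime⇒nonZero p-prime

    p∣n : p ∣ n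
    p∣n = m*n∣⇒m∣ p p p²∣n

    withP withoutP : ℤ → List ℕ
    withP    s = filter (p ∣?_) (divisorsWithμ s)
    withoutP s = filter (¬? ∘ (p ∣?_)) (divisorsWithμ s)

    ∈-withoutP⁻ : ∀ {s} → e ∈ withoutP s → e ∣ n × μ e ≡ s × ¬ p ∣ e
    ∈-withoutP⁻ {s = s} e∈ with e∈L , p∤e ← ∈-filter⁻ (¬? ∘ (p ∣?_)) {xs = divisorsWithμ s} e∈ =
      let e∣n , μe≡s = ∈-divisorsWithμ⁻ e∈L in e∣n , μe≡s , p∤e

    -- n / e = p · (n / pe), and p still divides n / pe because p² ∣ n while p ∤ e.
    term-*p : ∀ {s} → e ∈ withoutP s → term (p * e) ≡ term e
    term-*p {e} e∈ with e∣n , _ , p∤e ← ∈-withoutP⁻ e∈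
                   with divides k n≡k*pe ← prime∤∧∣⇒*∣ p-prime p∤e e∣n p∣n = begin
      a (quot n (p * e))  ≡⟨ cong a (quot-≡ (prime*≥1 p-prime 1≤e) n≡k*pe) ⟩
      a k                 ≡⟨ a-rad p-prime 1≤k p∣k ⟨
      a (p * k)           ≡⟨ cong a (quot-≡ 1≤e n≡pk*e) ⟨
      a (quot n e)        ∎
      where
      open ≡-Reasoning
      1≤e : 1 ≤ e
      1≤e = ∣⇒≥1 1≤n e∣n
      1≤k : 1 ≤ k
      1≤k = ∣⇒≥1 1≤n (divides (p * e) (trans n≡k*pe (ℕ.*-comm k (p * e))))
      n≡pk*e : n ≡ p * k * e
      n≡pk*e = trans n≡k*pe (trans (sym (ℕ.*-assoc k p e)) (cong (_* e) (ℕ.*-comm k p)))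
      p∣k*e : p ∣ k * e
      p∣k*e = *-cancelˡ-∣ p (subst (p * p ∣_) (trans n≡pk*e (ℕ.*-assoc p k e)) p²∣n)
      p∣k : p ∣ k
      p∣k = fromInj₁ (λ p∣e → contradiction p∣e p∤e) (euclidsLemma k e p-prime p∣k*e)

    p*-↭ : ∀ {t} → t ≢ + 0 → map (p *_) (withoutP (ℤ.- t)) ↭ withP t
    p*-↭ {t} t≢0 = unique∧sameElements⇒↭ p*-unique withP-unique ⊆withP withP⊆
      where
      p*-unique : Unique (map (p *_) (withoutP (ℤ.- t)))
      p*-unique = Unique.map⁺ (ℕ.*-cancelˡ-≡ _ _ p) (Unique.filter⁺ _ (divisorsWithμ-unique (ℤ.- t)))
      withP-unique : Unique (withP t)
      withP-unique = Unique.filter⁺ _ (divisorsWithμ-unique t)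
      ⊆withP : ∀ {x} → x ∈ map (p *_) (withoutP (ℤ.- t)) → x ∈ withP t
      ⊆withP x∈ with e , e∈ , refl ← ∈-map⁻ (p *_) x∈ with e∣n , μe≡-t , p∤e ← ∈-withoutP⁻ e∈ =
        ∈-filter⁺ (p ∣?_) (∈-divisorsWithμ⁺ (prime∤∧∣⇒*∣ p-prime p∤e e∣n p∣n) μpe≡t) (m∣m*n e)
        where
        μpe≡t : μ (p * e) ≡ t
        μpe≡t = trans (μ-*-prime p-prime (∣⇒≥1 1≤n e∣n) p∤e)
                      (trans (cong ℤ.-_ μe≡-t) (ℤ.neg-involutive t))
      withP⊆ : ∀ {x} → x ∈ withP t → x ∈ map (p *_) (withoutP (ℤ.- t))
      withP⊆ x∈ with x∈L , divides e refl ← ∈-filter⁻ (p ∣?_) {xs = divisorsWithμ t} x∈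
                with x∣n , μx≡t ← ∈-divisorsWithμ⁻ x∈L =
        subst (_∈ map (p *_) (withoutP (ℤ.- t))) (ℕ.*-comm p e)
          (∈-map⁺ (p *_) (∈-filter⁺ (¬? ∘ (p ∣?_)) (∈-divisorsWithμ⁺ e∣n μe≡-t) p∤e))
        where
        e∣n : e ∣ n
        e∣n = m*n∣⇒m∣ e p x∣n
        p∤e : ¬ p ∣ e
        p∤e = squareFree⇒∤ p-prime (subst SquareFree (ℕ.*-comm e p)
                (μ≢0⇒SquareFree (∣⇒≥1 1≤n x∣n) (λ μx≡0 → t≢0 (trans (sym μx≡t) μx≡0))))
        μe≡-t : μ e ≡ ℤ.- t
        μe≡-t = μ-*-prime⁻ p-prime (∣⇒≥1 1≤n e∣n) p∤e (trans (cong μ (ℕ.*-comm p e)) μx≡t)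

    ∏-withP≡∏-withoutP : ∀ {t} → t ≢ + 0 → ∏ term (withP t) ≡ ∏ term (withoutP (ℤ.- t))
    ∏-withP≡∏-withoutP {t} t≢0 = begin
      ∏ term (withP t)                            ≡⟨ ∏-↭ term (p*-↭ t≢0) ⟨
      ∏ term (map (p *_) (withoutP (ℤ.- t)))      ≡⟨ ∏-map term (p *_) (withoutP (ℤ.- t)) ⟩
      ∏ (term ∘ (p *_)) (withoutP (ℤ.- t))        ≡⟨ ∏-cong (withoutP (ℤ.- t)) term-*p ⟩
      ∏ term (withoutP (ℤ.- t))                   ∎
      where open ≡-Reasoning

    ∏[μ≡1]≡∏[μ≡-1] : ∏ term (divisorsWithμ ℤ.1ℤ) ≡ ∏ term (divisorsWithμ ℤ.-1ℤ)
    ∏[μ≡1]≡∏[μ≡-1] = begin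
      ∏ term (divisorsWithμ ℤ.1ℤ)
        ≡⟨ ∏-filter (p ∣?_) term (divisorsWithμ ℤ.1ℤ) ⟩
      ∏ term (withP ℤ.1ℤ) ℤ.* ∏ term (withoutP ℤ.1ℤ)
        ≡⟨ cong₂ ℤ._*_ (∏-withP≡∏-withoutP (λ ())) (sym (∏-withP≡∏-withoutP (λ ()))) ⟩
      ∏ term (withoutP ℤ.-1ℤ) ℤ.* ∏ term (withP ℤ.-1ℤ)
        ≡⟨ ℤ.*-comm (∏ term (withoutP ℤ.-1ℤ)) _ ⟩
      ∏ term (withP ℤ.-1ℤ) ℤ.* ∏ term (withoutP ℤ.-1ℤ)
        ≡⟨ ∏-filter (p ∣?_) term (divisorsWithμ ℤ.-1ℤ) ⟨
      ∏ term (divisorsWithμ ℤ.-1ℤ)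
        ∎
      where open ≡-Reasoning

  module SquareFreeCase (a₁≡0 : a 1 ≡ + 0) (p∣aₚ : ∀ {p} → Prime p → + p ℤ∣.∣ a p)
                        (n-sf : SquareFree n) {s} (μn≡s : μ n ≡ s) where

    ∏[μ≡μn]≡0 : ∏ term (divisorsWithμ s) ≡ + 0
    ∏[μ≡μn]≡0 = ℤ∣.0∣⇒≡0 (subst (ℤ∣._∣ ∏ term (divisorsWithμ s)) termₙ≡0
                                  (∈⇒∣∏ term _ (∈-divisorsWithμ⁺ ∣-refl μn≡s)))
      where
      termₙ≡0 : term n ≡ + 0
      termₙ≡0 = trans (cong a (quot-≡ 1≤n (sym (ℕ.*-identityˡ n)))) a₁≡0

    n∣∏[μ≡-μn] : + n ℤ∣.∣ ∏ term (divisorsWithμ (ℤ.- s))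
    n∣∏[μ≡-μn] = ℤ∣.∣ᵤ⇒∣ (squareFree⇒∣ n 1≤n n-sf p∣∏)
      where
      p∣∏ : ∀ {p} → Prime p → p ∣ n → p ∣ ℤ.∣ ∏ term (divisorsWithμ (ℤ.- s)) ∣
      p∣∏ {p} p-prime p∣n = ℤ∣.∣⇒∣ᵤ (ℤ∣.∣-trans (p∣aₚ p-prime)
        (subst (ℤ∣._∣ ∏ term (divisorsWithμ (ℤ.- s))) term[n/p]≡aₚ
               (∈⇒∣∏ term _ (∈-divisorsWithμ⁺ n/p∣n μ[n/p]≡-s))))
        where
        n/p : ℕ
        n/p = quotient p∣n
        n≡p*n/p : n ≡ p * n/p
        n≡p*n/p = m∣n⇒n≡m*quotient p∣n
        n/p∣n : n/p ∣ n
        n/p∣n = quotient-∣ p∣n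
        1≤n/p : 1 ≤ n/p
        1≤n/p = ∣⇒≥1 1≤n n/p∣n
        term[n/p]≡aₚ : term n/p ≡ a p
        term[n/p]≡aₚ = cong a (quot-≡ 1≤n/p n≡p*n/p)
        p∤n/p : ¬ p ∣ n/p
        p∤n/p = squareFree⇒∤ p-prime (subst SquareFree n≡p*n/p n-sf)
        μ[n/p]≡-s : μ n/p ≡ ℤ.- s
        μ[n/p]≡-s = μ-*-prime⁻ p-prime 1≤n/p p∤n/p (trans (cong μ (sym n≡p*n/p)) μn≡s)

radicalInvariant⇒eulerGauss : ∀ {a} → RadicalInvariant a → a 1 ≡ + 0 →
                              (∀ {p} → Prime p → + p ℤ∣.∣ a p) → EulerGauss a
radicalInvariant⇒eulerGauss {a} a-rad a₁≡0 p∣aₚ n 1≤n = ℤ∣.∣⇒∣ᵤ n∣∏-∏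
  where
  open EulerGaussCongruence a a-rad 1≤n
  n∣∏-∏ : + n ℤ∣.∣ ∏ term (divisorsWithμ ℤ.1ℤ) ℤ.- ∏ term (divisorsWithμ ℤ.-1ℤ)
  n∣∏-∏ with squareFree-dichotomy 1≤n
  ... | inj₂ (p , p-prime , p²∣n) rewrite NonSquareFree.∏[μ≡1]≡∏[μ≡-1] p-prime p²∣n =
    subst (+ n ℤ∣.∣_) (sym (ℤ.+-inverseʳ (∏ term (divisorsWithμ ℤ.-1ℤ)))) (∣0 (+ n))
  ... | inj₁ n-sf with μ-SquareFree-±1 n-sf
  ...   | inj₁ μn≡1  rewrite SquareFreeCase.∏[μ≡μn]≡0 a₁≡0 p∣aₚ n-sf μn≡1 =
    ℤ∣.∣m∣n⇒∣m-n (∣0 (+ n)) (SquareFreeCase.n∣∏[μ≡-μn] a₁≡0 p∣aₚ n-sf μn≡1)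
  ...   | inj₂ μn≡-1 rewrite SquareFreeCase.∏[μ≡μn]≡0 a₁≡0 p∣aₚ n-sf μn≡-1 =
    ℤ∣.∣m∣n⇒∣m-n (SquareFreeCase.n∣∏[μ≡-μn] a₁≡0 p∣aₚ n-sf μn≡-1) (∣0 (+ n))

module DivisorSum (g : ℕ → ℕ → ℤ) (g₁≡0 : ∀ n → 1 ≤ n → g 1 n ≡ + 0)
                  (g-rad : ∀ d n → 1 ≤ n → d ∣ n → g d n ≡ g d (rad n)) where

  term : ℕ → ℕ → ℤ
  term n d = + d ℤ.* (μ d ℤ.* g d n)

  a : ℕ → ℤ
  a n = ∑ (term n) (divisors n)

  term-μ≡0 : ∀ n d → μ d ≡ + 0 → term n d ≡ + 0
  term-μ≡0 n d μd≡0 = trans (cong (+ d ℤ.*_) (trans (cong (ℤ._* g d n) μd≡0) (ℤ.*-zeroˡ (g d n))))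
                              (ℤ.*-zeroʳ (+ d))

  a-radicalInvariant : RadicalInvariant a
  a-radicalInvariant {p} {N} p-prime 1≤N p∣N = begin
    ∑ (term (p * N)) (divisors (p * N))
      ≡⟨ ∑-filter (_∣? N) (term (p * N)) (divisors (p * N)) ⟩
    ∑ (term (p * N)) ∣N ℤ.+ ∑ (term (p * N)) ∤N
      ≡⟨ cong₂ ℤ._+_ (∑-cong ∣N term-p*N≡term-N) (∑-0 ∤N ∤N-vanish) ⟩
    ∑ (term N) ∣N ℤ.+ + 0
      ≡⟨ ℤ.+-identityʳ _ ⟩
    ∑ (term N) ∣N
      ≡⟨ ∑-↭ (term N) (divisors-filter-∣ 1≤p*N (n∣m*n p)) ⟩
    ∑ (term N) (divisors N)
      ∎
    where
    open ≡-Reasoning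
    1≤p*N : 1 ≤ p * N
    1≤p*N = prime*≥1 p-prime 1≤N
    ∣N ∤N : List ℕ
    ∣N = filter (_∣? N) (divisors (p * N))
    ∤N = filter (¬? ∘ (_∣? N)) (divisors (p * N))
    term-p*N≡term-N : ∀ {d} → d ∈ ∣N → term (p * N) d ≡ term N d
    term-p*N≡term-N {d} d∈ with d∈divisors , d∣N ← ∈-filter⁻ (_∣? N) {xs = divisors (p * N)} d∈ =
      cong (λ x → + d ℤ.* (μ d ℤ.* x)) (begin
        g d (p * N)          ≡⟨ g-rad d (p * N) 1≤p*N (∈-divisors⁻ d∈divisors) ⟩
        g d (rad (p * N))    ≡⟨ cong (g d) (rad-*-∣ p-prime 1≤N p∣N) ⟩
        g d (rad N)          ≡⟨ g-rad d N 1≤N d∣N ⟨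
        g d N                ∎)
    ∤N-vanish : ∀ {d} → d ∈ ∤N → term (p * N) d ≡ + 0
    ∤N-vanish {d} d∈ with d∈divisors , d∤N ← ∈-filter⁻ (¬? ∘ (_∣? N)) {xs = divisors (p * N)} d∈
                     with μ d ℤ.≟ + 0
    ... | yes μd≡0 = term-μ≡0 (p * N) d μd≡0
    ... | no  μd≢0 =
      contradiction (squareFree∧∣p*N⇒∣N p-prime p∣N 1≤d (μ≢0⇒SquareFree 1≤d μd≢0) d∣p*N) d∤N
      where
      d∣p*N : d ∣ p * N
      d∣p*N = ∈-divisors⁻ d∈divisors
      1≤d : 1 ≤ d
      1≤d = ∣⇒≥1 1≤p*N d∣p*N

  a₁≡0 : a 1 ≡ + 0
  a₁≡0 rewrite g₁≡0 1 (s≤s z≤n) = refl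

  p∣aₚ : Prime p → + p ℤ∣.∣ a p
  p∣aₚ {p} p-prime = ∣-∑ (term p) (divisors p) p∣term
    where
    p∣term : ∀ {d} → d ∈ divisors p → + p ℤ∣.∣ term p d
    p∣term d∈ with prime⇒irreducible p-prime (∈-divisors⁻ d∈)
    ... | inj₁ refl rewrite g₁≡0 p (prime⇒≥1 p-prime) = ∣0 (+ p)
    ... | inj₂ refl = ℤ∣.∣m⇒∣m*n _ ℤ∣.∣-refl

module PrimeDivisorSum (f : ℕ → ℕ → ℤ) where

  term : ℕ → ℕ → ℤ
  term r q = + q ℤ.* f q r

  a : ℕ → ℤ
  a n = ∑ (term (rad n)) (primeDivisors n)

  a-radicalInvariant : RadicalInvariant a
  a-radicalInvariant {p} {N} p-prime 1≤N p∣N = begin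
    ∑ (term (rad (p * N))) (primeDivisors (p * N))
      ≡⟨ cong (λ r → ∑ (term r) (primeDivisors (p * N))) (rad-*-∣ p-prime 1≤N p∣N) ⟩
    ∑ (term (rad N)) (primeDivisors (p * N))
      ≡⟨ ∑-↭ (term (rad N)) (primeDivisors-*-∣ p-prime 1≤N p∣N) ⟩
    ∑ (term (rad N)) (primeDivisors N)
      ∎
    where open ≡-Reasoning

  a₁≡0 : a 1 ≡ + 0
  a₁≡0 = refl

  p∣aₚ : Prime p → + p ℤ∣.∣ a p
  p∣aₚ {p} p-prime = ∣-∑ (term (rad p)) (primeDivisors p) p∣term
    where
    p∣term : ∀ {q} → q ∈ primeDivisors p → + p ℤ∣.∣ term (rad p) q
    p∣term q∈ with q-prime , q∣p ← ∈-primeDivisors⁻ q∈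
              with refl ← prime∣prime⇒≡ q-prime p-prime q∣p =
      ℤ∣.∣m⇒∣m*n _ ℤ∣.∣-refl

corollary1 : (∀ (g : ℕ → ℕ → ℤ) →
    (∀ (n : ℕ) → 1 ≤ n → g 1 n ≡ + 0) →
    (∀ (d n : ℕ) → 1 ≤ n → d ∣ n → g d n ≡ g d (rad n)) →
    EulerGauss (λ n → sumℤ (map (λ d → (+ d) ℤ.* (μ d ℤ.* g d n)) (divisors n))))
    ×
    (∀ (f : ℕ → ℕ → ℤ) →
    EulerGauss (λ n → sumℤ (map (λ p → (+ p) ℤ.* f p (rad n)) (primeDivisors n))))
corollary1 =
  (λ g g₁≡0 g-rad → let open DivisorSum g g₁≡0 g-rad in
                    radicalInvariant⇒eulerGauss a-radicalInvariant a₁≡0 p∣aₚ) ,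
  (λ f → let open PrimeDivisorSum f in
         radicalInvariant⇒eulerGauss a-radicalInvariant a₁≡0 p∣aₚ)
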